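{- Let $\mathcal O$ be the DL-Lite ontology $\{A\sqsubseteq\neg A\}$ for a concept name $A$. Then neither $\mathcal{L}(\geq)$ nor $\mathcal{L}(\forall,\exists,\sqcap)$ admits finite characterisations under $\mathcal O$.
   Context: For a set $\mathbf O$ of constructors and finite sets $\Sigma_C$ of concept names and $\Sigma_R$ of role names, $\mathcal L(\mathbf O)[\Sigma_C,\Sigma_R]$ is the set of concepts built from concept names in $\Sigma_C$ using only constructors from $\mathbf O$, with role names from $\Sigma_R$; here $\geq k\,R.C$ ($k\ge1$) denotes elements with at least $k$ pairwise distinct $R$-successors in $C$, and $\forall R.C$, $\exists R.C$, $\sqcap$ have standard semantics. An interpretation $\mathcal I$ satisfies $\mathcal O=\{A\sqsubseteq\neg A\}$ iff $A^{\mathcal I}=\emptyset$. $C\equiv_{\mathcal O}D$ if $C^{\mathcal I}=D^{\mathcal I}$ for all $\mathcal I\models\mathcal O$. An example for $\mathcal O$ is a finite pointed interpretation $(\mathcal I,d)$ with $\mathcal I\models\mathcal O$, labelled positive or negative; $C$ fits $E=(E^+,E^-)$ if $d\in C^{\mathcal I}$ for positive and $d\notin C^{\mathcal I}$ for negative examples. A finite characterisation of $C$ w.r.t. $\mathcal L$ under $\mathcal O$ is a finite collection $E$ of examples for $\mathcal O$ that $C$ fits such that every $D\in\mathcal L$ fitting $E$ satisfies $C\equiv_{\mathcal O}D$. $\mathcal L(\mathbf O)$ admits finite characterisations under $\mathcal O$ if for all finite $\Sigma_C,\Sigma_R$, every $C\in\mathcal L(\mathbf O)[\Sigma_C,\Sigma_R]$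 has a finite characterisation w.r.t. $\mathcal L(\mathbf O)[\Sigma_C,\Sigma_R]$ under $\mathcal O$. -}

module Defs where

open import Data.Nat using (ℕ; _≥_)
open import Data.Fin using (Fin)
open import Data.Bool using (Bool; true; false; T)
open import Data.List using (List)
open import Data.List.Membership.Propositional using (_∈_)
open import Data.List.Relation.Unary.All using (All)
open import Data.Product using (Σ; _×_; _,_)
open import Data.Unit using (⊤)
open import Relation.Binary.PropositionalEquality using (_≡_)
open import Function.Definitions using (Injective)
open import Function.Bundles using (_⇔_)
open import Level using (0ℓ)

ConceptName : Set
ConceptName = ℕ

RoleName : Set
RoleName = ℕ

-- Full concept syntax (⊤ and concept names are atomic; the others are
-- the constructors that a fragment L(O) may allow).
data Concept : Set where
  top     : Concept
  name    : ConceptName → Concept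
  _⊓_     : Concept → Concept → Concept
  ∃[_]_   : RoleName → Concept → Concept
  ∀[_]_   : RoleName → Concept → Concept
  ≥[_,_]_ : ℕ → RoleName → Concept → Concept

data Constr : Set where
  cAnd cEx cAll cAtLeast : Constr

data InL (O : List Constr) (ΣC : List ConceptName) (ΣR : List RoleName) : Concept → Set where
  in-top     : InL O ΣC ΣR top
  in-name    : ∀ {a} → a ∈ ΣC → InL O ΣC ΣR (name a)
  in-and     : ∀ {C D} → cAnd ∈ O → InL O ΣC ΣR C → InL O ΣC ΣR D → InL O ΣC ΣR (C ⊓ D)
  in-ex      : ∀ {r C} → cEx ∈ O → r ∈ ΣR → InL O ΣC ΣR C → InL O ΣC ΣR (∃[ r ] C)
  in-all     : ∀ {r C} → cAll ∈ O → r ∈ ΣR → InL O ΣC ΣR C → InL O ΣC ΣR (∀[ r ] C)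
  in-atleast : ∀ {k r C} → cAtLeast ∈ O → k ≥ 1 → r ∈ ΣR → InL O ΣC ΣR C → InL O ΣC ΣR (≥[ k , r ] C)

-- Arbitrary (possibly infinite) interpretations.
record Interp : Set₁ where
  field
    Δ    : Set
    conc : ConceptName → Δ → Set
    role : RoleName → Δ → Δ → Set
open Interp public

⟦_⟧ : Concept → (I : Interp) → Δ I → Set
⟦ top ⟧ I d = ⊤
⟦ name a ⟧ I d = conc I a d
⟦ C ⊓ D ⟧ I d = ⟦ C ⟧ I d × ⟦ D ⟧ I d
⟦ ∃[ r ] C ⟧ I d = Σ (Δ I) λ e → role I r d e × ⟦ C ⟧ I e
⟦ ∀[ r ] C ⟧ I d = (e : Δ I) → role I r d e → ⟦ C ⟧ I e
⟦ ≥[ k , r ] C ⟧ I d =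
  Σ (Fin k → Δ I) λ f → Injective _≡_ _≡_ f × ((i : Fin k) → role I r d (f i) × ⟦ C ⟧ I (f i))

-- I ⊨ {A ⊑ ¬A}  iff  A^I = ∅
Models : ConceptName → Interp → Set
Models A I = (d : Δ I) → conc I A d → Data.Empty.⊥
  where import Data.Empty

EquivO : ConceptName → Concept → Concept → Set₁
EquivO A C D = (I : Interp) → Models A I → (d : Δ I) → ⟦ C ⟧ I d ⇔ ⟦ D ⟧ I d

record FinInterp : Set where
  field
    size  : ℕ
    fconc : ConceptName → Fin size → Bool
    frole : RoleName → Fin size → Fin size → Bool

toInterp : FinInterp → Interp
toInterp J = record
  { Δ = Fin (FinInterp.size J)
  ; conc = λ a d → T (FinInterp.fconc J a d)
  ; role = λ r d e → T (FinInterp.frole J r d e) }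

record Example : Set where
  field
    interp : FinInterp
    point  : Fin (FinInterp.size interp)
open Example public

IsExampleFor : ConceptName → Example → Set
IsExampleFor A e = Models A (toInterp (interp e))

Holds : Concept → Example → Set
Holds C e = ⟦ C ⟧ (toInterp (interp e)) (point e)

Fits : Concept → List Example → List Example → Set
Fits C Epos Eneg = All (Holds C) Epos × All (λ e → Holds C e → Data.Empty.⊥) Eneg
  where import Data.Empty

FiniteCharacterisation : ConceptName → List Constr → List ConceptName → List RoleName → Concept → Set₁
FiniteCharacterisation A O ΣC ΣR C =
  Σ (List Example) λ Epos → Σ (List Example) λ Eneg →
    All (IsExampleFor A) Epos × All (IsExampleFor A) Eneg ×
    Fits C Epos Eneg ×
    ((D : Concept) → InL O ΣC ΣR D → Fits D Epos Eneg → EquivO A C D)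

AdmitsFiniteCharacterisations : ConceptName → List Constr → Set₁
AdmitsFiniteCharacterisations A O =
  (ΣC : List ConceptName) (ΣR : List RoleName) (C : Concept) →
  InL O ΣC ΣR C → FiniteCharacterisation A O ΣC ΣR C

-- Under O = {A ⊑ ¬A} the concept A is unsatisfiable, so it has no positive
-- examples, and any D ∈ L fitting its negative examples must be unsatisfiable
-- too.  For each N we give a satisfiable D_N ∈ L that is false at every
-- example of size at most N, which defeats any finite set of examples.  In
-- L(≥) this is ≥ (N+1) r.⊤.  In L(∀,∃,⊓) it is ∀ʳ^(N+1).A ⊓ ∃ʳ^N.⊤: an
-- r-path of length N in a model of size ≤ N repeats a vertex, hence extends
-- to arbitrary length, contradicting ∀ʳ^(N+1).A; a finite r-chain of length N
-- satisfies it.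
module Submission where

open import Defs
open import Data.List using (List; []; _∷_)
open import Relation.Nullary using (¬_)
open import Data.Nat using (ℕ; zero; suc; _+_; _≤_; _<_; z≤n; s≤s)
open import Data.Nat.Properties
  using (m≤m+n; m≤n+m; ≤-refl; ≤-trans; <-≤-trans; <⇒≱; n<1+n; m≤n⇒m<n∨m≡n; +-suc; +-identityʳ)
open import Data.Fin using (toℕ)
open import Data.Fin.Properties using (pigeonhole; injective⇒≤; toℕ-injective; toℕ<n)
open import Data.Empty using (⊥; ⊥-elim)
open import Data.Unit using (⊤; tt)
open import Data.Product using (Σ; _×_; _,_)
open import Data.Sum using (inj₁; inj₂)
open import Data.List.Relation.Unary.All as All using (All; []; _∷_)
open import Data.List.Relation.Unary.Any using (here; there)
open import Function.Bundles using (Equivalence)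
open import Relation.Binary.PropositionalEquality using (_≡_; refl; sym; subst)

exampleSize : Example → ℕ
exampleSize e = FinInterp.size (interp e)

totalSize : List Example → ℕ
totalSize [] = 0
totalSize (e ∷ es) = exampleSize e + totalSize es

All-exampleSize≤totalSize : (es : List Example) → All (λ e → exampleSize e ≤ totalSize es) es
All-exampleSize≤totalSize [] = []
All-exampleSize≤totalSize (e ∷ es) =
  m≤m+n (exampleSize e) (totalSize es) ∷
  All.map (λ le → ≤-trans le (m≤n+m (totalSize es) (exampleSize e))) (All-exampleSize≤totalSize es)

unsatisfiable-name-not-characterised :
  ∀ {A O ΣC ΣR} (D : ℕ → Concept) →
  (∀ N → InL O ΣC ΣR (D N)) →
  (∀ N e → IsExampleFor A e → exampleSize e ≤ N → ¬ Holds (D N) e) →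
  (∀ N → Σ Interp λ I → Models A I × Σ (Δ I) (⟦ D N ⟧ I)) →
  ¬ FiniteCharacterisation A O ΣC ΣR (name A)
unsatisfiable-name-not-characterised D D∈L small-refutes satisfiable
  (Epos , Eneg , posExamples , negExamples , (posFit , _) , characterises)
  with I , I⊨O , d , d∈D ← satisfiable (totalSize Eneg)
  = I⊨O d (Equivalence.from (characterises (D N) (D∈L N) D-fits I I⊨O d) d∈D)
  where
  N = totalSize Eneg
  D-fits : Fits (D N) Epos Eneg
  D-fits = All.zipWith (λ (ex , holds) → ⊥-elim (ex _ holds)) (posExamples , posFit)
         , All.zipWith (λ (ex , le) → small-refutes N _ ex le) (negExamples , All-exampleSize≤totalSize Eneg)

atLeast≤size : ∀ (J : FinInterp) {k r C d} →
  ⟦ ≥[ k , r ] C ⟧ (toInterp J) d → k ≤ FinInterp.size J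
atLeast≤size J (_ , injective , _) = injective⇒≤ injective

complete : Interp
complete = record { Δ = ℕ ; conc = λ _ _ → ⊥ ; role = λ _ _ _ → ⊤ }

atLeast-complete : ∀ k r → ⟦ ≥[ k , r ] top ⟧ complete 0
atLeast-complete k r = toℕ , toℕ-injective , λ _ → tt , tt

L≥-not-admits : (A : ConceptName) → ¬ AdmitsFiniteCharacterisations A (cAtLeast ∷ [])
L≥-not-admits A admits =
  unsatisfiable-name-not-characterised D
    (λ N → in-atleast (here refl) (s≤s z≤n) (here refl) in-top)
    (λ N e _ le holds → <⇒≱ (s≤s le) (atLeast≤size (interp e) {C = top} holds))
    (λ N → complete , (λ _ ()) , 0 , atLeast-complete (suc N) 0)
    (admits (A ∷ []) (0 ∷ []) (name A) (in-name (here refl)))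
  where
  D : ℕ → Concept
  D N = ≥[ suc N , 0 ] top

∃^[_,_] : RoleName → ℕ → Concept
∃^[ r , zero ] = top
∃^[ r , suc k ] = ∃[ r ] ∃^[ r , k ]

∀^[_,_]_ : RoleName → ℕ → Concept → Concept
∀^[ r , zero ] C = C
∀^[ r , suc k ] C = ∀[ r ] ∀^[ r , k ] C

∃^-unsat-under-∀^ : ∀ (I : Interp) {r C} → (∀ e → ¬ ⟦ C ⟧ I e) →
  ∀ k d → ⟦ ∀^[ r , k ] C ⟧ I d → ¬ ⟦ ∃^[ r , k ] ⟧ I d
∃^-unsat-under-∀^ I C-empty zero d C-holds _ = C-empty d C-holds
∃^-unsat-under-∀^ I C-empty (suc k) d ∀-holds (e , de , ∃-holds) =
  ∃^-unsat-under-∀^ I C-empty k e (∀-holds e de) ∃-holds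

IsPath : (I : Interp) → RoleName → ℕ → (ℕ → Δ I) → Set
IsPath I r k v = ∀ t → t < k → role I r (v t) (v (suc t))

∃^⇒path : ∀ (I : Interp) {r} k d → ⟦ ∃^[ r , k ] ⟧ I d →
  Σ (ℕ → Δ I) λ v → v 0 ≡ d × IsPath I r k v
∃^⇒path I zero d _ = (λ _ → d) , refl , λ _ ()
∃^⇒path I (suc k) d (e , de , ∃-holds) with v , refl , path ← ∃^⇒path I k e ∃-holds =
  v′ , refl , path′
  where
  v′ : ℕ → Δ I
  v′ zero = d
  v′ (suc t) = v t
  path′ : IsPath I _ (suc k) v′
  path′ zero _ = de
  path′ (suc t) (s≤s t<k) = path t t<k

-- A path v₀ … v_j with v_j = v_i (i < j) is a lasso: from v_j one may jump back
-- to v_{i+1}, so it is never left.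
lasso⇒∃^ : ∀ (I : Interp) {r i j} (v : ℕ → Δ I) → IsPath I r j v → i < j → v j ≡ v i →
  ∀ k t → t ≤ j → ⟦ ∃^[ r , k ] ⟧ I (v t)
lasso⇒∃^ I v path i<j loop zero t _ = tt
lasso⇒∃^ I {r} {i} v path i<j loop (suc k) t t≤j with m≤n⇒m<n∨m≡n t≤j
... | inj₁ t<j = v (suc t) , path t t<j , lasso⇒∃^ I v path i<j loop k (suc t) t<j
... | inj₂ refl =
  v (suc i) , subst (λ x → role I r x (v (suc i))) (sym loop) (path i i<j) ,
  lasso⇒∃^ I v path i<j loop k (suc i) i<j

∃^-pumping : ∀ (J : FinInterp) {r m} d → FinInterp.size J ≤ m →
  ⟦ ∃^[ r , m ] ⟧ (toInterp J) d → ∀ k → ⟦ ∃^[ r , k ] ⟧ (toInterp J) d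
∃^-pumping J {m = m} d size≤m ∃-holds k
  with v , refl , path ← ∃^⇒path (toInterp J) m d ∃-holds
  with i , j , i<j , vi≡vj ← pigeonhole (n<1+n (FinInterp.size J)) (λ x → v (toℕ x))
  = lasso⇒∃^ (toInterp J) v (λ t t<j → path t (<-≤-trans t<j j≤m)) i<j (sym vi≡vj) k 0 z≤n
  where
  j≤m : toℕ j ≤ m
  j≤m with s≤s j≤size ← toℕ<n j = ≤-trans j≤size size≤m

chain : ℕ → Interp
chain M = record { Δ = ℕ ; conc = λ _ _ → ⊥ ; role = λ _ d e → e ≡ suc d × e ≤ M }

∃^-chain : ∀ M {r} k d → k + d ≤ M → ⟦ ∃^[ r , k ] ⟧ (chain M) d
∃^-chain M zero d _ = tt
∃^-chain M (suc k) d le = suc d , (refl , ≤-trans (m≤n+m (suc d) k) le′) , ∃^-chain M k (suc d) le′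
  where
  le′ : k + suc d ≤ M
  le′ = subst (_≤ M) (sym (+-suc k d)) le

∀^-chain : ∀ M {r C} k d → M < suc k + d → ⟦ ∀^[ r , suc k ] C ⟧ (chain M) d
∀^-chain M zero d M<1+d .(suc d) (refl , 1+d≤M) = ⊥-elim (<⇒≱ M<1+d 1+d≤M)
∀^-chain M (suc k) d M<k+2+d .(suc d) (refl , _) =
  ∀^-chain M k (suc d) (subst (M <_) (sym (+-suc (suc k) d)) M<k+2+d)

L∀∃⊓-not-admits : (A : ConceptName) → ¬ AdmitsFiniteCharacterisations A (cAll ∷ cEx ∷ cAnd ∷ [])
L∀∃⊓-not-admits A admits =
  unsatisfiable-name-not-characterised D
    (λ N → in-and (there (there (here refl))) (∀^∈L (suc N)) (∃^∈L N))
    (λ N e ex le (∀-holds , ∃-holds) →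
      ∃^-unsat-under-∀^ (toInterp (interp e)) ex (suc N) (point e) ∀-holds
        (∃^-pumping (interp e) (point e) le ∃-holds (suc N)))
    (λ N → chain N , (λ _ ()) , 0 ,
      ∀^-chain N N 0 (subst (N <_) (sym (+-identityʳ (suc N))) (n<1+n N)) ,
      ∃^-chain N N 0 (subst (_≤ N) (sym (+-identityʳ N)) ≤-refl))
    (admits (A ∷ []) (0 ∷ []) (name A) (in-name (here refl)))
  where
  D : ℕ → Concept
  D N = (∀^[ 0 , suc N ] name A) ⊓ ∃^[ 0 , N ]
  ∃^∈L : ∀ k → InL (cAll ∷ cEx ∷ cAnd ∷ []) (A ∷ []) (0 ∷ []) ∃^[ 0 , k ]
  ∃^∈L zero = in-top
  ∃^∈L (suc k) = in-ex (there (here refl)) (here refl) (∃^∈L k)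
  ∀^∈L : ∀ k → InL (cAll ∷ cEx ∷ cAnd ∷ []) (A ∷ []) (0 ∷ []) (∀^[ 0 , k ] name A)
  ∀^∈L zero = in-name (here refl)
  ∀^∈L (suc k) = in-all (here refl) (here refl) (∀^∈L k)

theorem15 : (A : ConceptName) →
    ¬ AdmitsFiniteCharacterisations A (cAtLeast ∷ [])
    × ¬ AdmitsFiniteCharacterisations A (cAll ∷ cEx ∷ cAnd ∷ [])
theorem15 A = L≥-not-admits A , L∀∃⊓-not-admits A
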